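{- Let $G$ be a finite, simple, connected graph of order $n$. If $G$ has a cycle, then $\beta(G)\leq n-g(G)+2$.
   Context: For vertices $x,y$ of a connected graph $G$, $d(x,y)$ denotes the length of a shortest $x$–$y$ path. A set $W\subseteq V(G)$ is a resolving set for $G$ if for every two distinct vertices $u,v\in V(G)$ there exists $w\in W$ with $d(u,w)\neq d(v,w)$. The metric dimension $\beta(G)$ is the minimum cardinality of a resolving set for $G$. If $G$ has a cycle, the girth $g(G)$ is the length of a shortest cycle in $G$. -}

module Defs where

open import Data.Nat using (ℕ; zero; suc; _<_; _≤_)
open import Data.Bool using (Bool; true; false)
open import Data.Fin using (Fin; inject₁; fromℕ) renaming (zero to fzero; suc to fsuc)
open import Data.Fin.Subset using (Subset; _∈_)
open import Data.Product using (Σ; ∃; _×_; _,_)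
open import Function.Definitions using (Injective)
open import Relation.Binary.PropositionalEquality using (_≡_; _≢_)
open import Relation.Nullary using (¬_)

record Graph (n : ℕ) : Set where
  field
    adj     : Fin n → Fin n → Bool
    sym     : ∀ x y → adj x y ≡ adj y x
    irrefl  : ∀ x → adj x x ≡ false

open Graph public

Adj : ∀ {n} → Graph n → Fin n → Fin n → Set
Adj G x y = adj G x y ≡ true

data Walk {n : ℕ} (G : Graph n) : Fin n → Fin n → ℕ → Set where
  [] : ∀ {x} → Walk G x x 0
  _∷_ : ∀ {x y z k} → Adj G x y → Walk G y z k → Walk G x z (suc k)

Connected : ∀ {n} → Graph n → Set
Connected G = ∀ x y → ∃ λ k → Walk G x y k

IsDist : ∀ {n} → Graph n → Fin n → Fin n → ℕ → Set
IsDist G x y k = Walk G x y k × (∀ j → j < k → ¬ Walk G x y j)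

record Cycle {n : ℕ} (G : Graph n) (ℓ : ℕ) : Set where
  field
    m       : ℕ
    len     : ℓ ≡ suc (suc (suc m))
    vtx     : Fin (suc (suc (suc m))) → Fin n
    inj     : Injective _≡_ _≡_ vtx
    step    : ∀ (i : Fin (suc (suc m))) → Adj G (vtx (inject₁ i)) (vtx (fsuc i))
    close   : Adj G (vtx (fromℕ (suc (suc m)))) (vtx fzero)

HasCycle : ∀ {n} → Graph n → Set
HasCycle G = ∃ λ ℓ → Cycle G ℓ

IsGirth : ∀ {n} → Graph n → ℕ → Set
IsGirth G g = Cycle G g × (∀ ℓ → ℓ < g → ¬ Cycle G ℓ)

Resolving : ∀ {n} → Graph n → Subset n → Set
Resolving {n} G W =
  ∀ (u v : Fin n) → u ≢ v →
    Σ (Fin n) λ w → w ∈ W × Σ ℕ λ a → Σ ℕ λ b →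
      IsDist G u w a × IsDist G v w b × a ≢ b

-- β(G) ≤ k  :⇔  the minimum size of a resolving set is at most k,
-- i.e. some resolving set has cardinality ≤ k.
MetricDimLe : ∀ {n} → Graph n → ℕ → Set
MetricDimLe {n} G k = Σ (Subset n) λ W → Resolving G W × Data.Fin.Subset.∣ W ∣ ≤ k

-- Let c₀ … c_{g−1} be a shortest cycle. It is isometric: a walk between two of its vertices
-- shorter than both arcs would close a cycle shorter than g, so d(c_a, c₀) = min(a, g − a).
-- Remove the g − 2 inner vertices c₁ … c_{g−2} from V. A remaining vertex separates itself
-- from any other vertex, and two inner vertices not separated by c₀ are mirror images
-- c_a, c_{g−a}, which c_{g−1} separates.
module Submission where

open import Defs
open import Data.Nat using (ℕ; zero; suc; _+_; _∸_; _≤_; _<_; z≤n; s≤s; z<s; _≤?_)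
open import Data.Nat.Properties
open import Data.Bool using (true)
import Data.Bool as Bool
open import Data.Fin using (Fin; inject₁; fromℕ; toℕ) renaming (zero to fzero; suc to fsuc)
open import Data.Fin.Properties using (toℕ-injective; toℕ-inject₁; toℕ-fromℕ; toℕ<n; any?)
import Data.Fin.Properties as Fin
open import Data.Fin.Subset using (Subset; ∣_∣; _∈_; ⊤; _-_)
open import Data.Fin.Subset.Properties using (∈⊤; x∈p∧x≢y⇒x∈p-y; x∈p⇒∣p-x∣<∣p∣; ∣p∣≤n)
open import Data.Product using (Σ; ∃; _×_; _,_; proj₂)
open import Data.Sum using (_⊎_; inj₁; inj₂)
open import Data.Empty using (⊥-elim)
open import Function using (_∘_)
open import Function.Definitions using (Injective)
open import Relation.Binary.PropositionalEquality using (_≡_; _≢_; refl; cong; trans; subst)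
import Relation.Binary.PropositionalEquality as ≡
open import Relation.Nullary using (¬_; Dec; yes; no)
open import Relation.Nullary.Decidable using (map′; _×-dec_)
open import Relation.Unary using (Decidable)

module _ {p} {P : ℕ → Set p} (P? : Decidable P) where

  minimal-witness : ∀ {k} → P k → ∃ λ d → P d × (∀ j → j < d → ¬ P j)
  minimal-witness {k} = search 0 k (λ ())
    where
    search : ∀ i fuel → (∀ {j} → j < i → ¬ P j) → P (i + fuel) → ∃ λ d → P d × (∀ j → j < d → ¬ P j)
    search i zero below p = i , subst P (+-identityʳ i) p , λ _ → below
    search i (suc fuel) below p with P? i
    ... | yes pi = i , pi , λ _ → below
    ... | no ¬pi = search (suc i) fuel below′ (subst P (+-suc i fuel) p)
      where
      below′ : ∀ {j} → j < suc i → ¬ P j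
      below′ j<1+i with m<1+n⇒m<n∨m≡n j<1+i
      ... | inj₁ j<i  = below j<i
      ... | inj₂ refl = ¬pi

clamp : ∀ k → ℕ → Fin (suc k)
clamp k       zero    = fzero
clamp zero    (suc i) = fzero
clamp (suc k) (suc i) = fsuc (clamp k i)

toℕ-clamp : ∀ {k i} → i ≤ k → toℕ (clamp k i) ≡ i
toℕ-clamp {k}     {zero}  _         = refl
toℕ-clamp {suc k} {suc i} (s≤s i≤k) = cong suc (toℕ-clamp i≤k)

inject₁-clamp : ∀ {k i} → i ≤ k → inject₁ (clamp k i) ≡ clamp (suc k) i
inject₁-clamp {k}     {zero}  _         = refl
inject₁-clamp {suc k} {suc i} (s≤s i≤k) = cong fsuc (inject₁-clamp i≤k)

clamp-self : ∀ k → clamp k k ≡ fromℕ k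
clamp-self zero    = refl
clamp-self (suc k) = cong fsuc (clamp-self k)

-- d = min a (g − a), the distance between vertices a steps apart on a g-cycle,
-- stated without truncated subtraction.
CycleDistance : ℕ → ℕ → ℕ → Set
CycleDistance g a d = (d ≡ a ⊎ d + a ≡ g) × d ≤ a × d + a ≤ g

-- Equidistant positions a < b are mirror images (a + b = g); moving both one step
-- towards g brings b strictly closer than a.
cycleDistance-suc-< : ∀ {g a b e f} → a + b ≡ g → a < b →
                      CycleDistance g (suc a) e → CycleDistance g (suc b) f → f < e
cycleDistance-suc-< {g} {a} {b} {e} {f} a+b≡g a<b (e≡ , _) (_ , _ , f+b≤g) = <-≤-trans f<a (a≤e e≡)
  where
  f<a : f < a
  f<a = +-cancelʳ-≤ b (suc f) a (subst (_≤ a + b) (+-suc f b) (subst (f + suc b ≤_) (≡.sym a+b≡g) f+b≤g))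
  a≤e : e ≡ suc a ⊎ e + suc a ≡ g → a ≤ e
  a≤e (inj₁ refl) = n≤1+n a
  a≤e (inj₂ e+a≡g) = ≤-pred (subst (suc a ≤_) b≡1+e a<b)
    where
    b≡1+e : b ≡ suc e
    b≡1+e = +-cancelʳ-≡ a b (suc e) (trans (+-comm b a) (trans a+b≡g (trans (≡.sym e+a≡g) (+-suc e a))))

cycleDistance-separates : ∀ {g a b d e f} → a ≢ b →
  CycleDistance g a d → CycleDistance g b d →
  CycleDistance g (suc a) e → CycleDistance g (suc b) f → e ≢ f
cycleDistance-separates a≢b (inj₁ refl , _) (inj₁ refl , _) _ _ = ⊥-elim (a≢b refl)
cycleDistance-separates {d = d} a≢b (inj₂ d+a≡g , _) (inj₂ d+b≡g , _) _ _ =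
  ⊥-elim (a≢b (+-cancelˡ-≡ d _ _ (trans d+a≡g (≡.sym d+b≡g))))
cycleDistance-separates a≢b (inj₁ refl , _) (inj₂ a+b≡g , a≤b , _) Ea Eb =
  <⇒≢ (cycleDistance-suc-< a+b≡g (≤∧≢⇒< a≤b a≢b) Ea Eb) ∘ ≡.sym
cycleDistance-separates a≢b (inj₂ b+a≡g , b≤a , _) (inj₁ refl , _) Ea Eb =
  <⇒≢ (cycleDistance-suc-< b+a≡g (≤∧≢⇒< b≤a (a≢b ∘ ≡.sym)) Eb Ea)

avoiding : ∀ {n k} → (Fin k → Fin n) → Subset n
avoiding {k = zero}  f = ⊤
avoiding {k = suc k} f = avoiding (f ∘ fsuc) - f fzero

∈avoiding : ∀ {n k} (f : Fin k → Fin n) {x} → (∀ i → x ≢ f i) → x ∈ avoiding f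
∈avoiding {k = zero}  f x∉f = ∈⊤
∈avoiding {k = suc k} f x∉f = x∈p∧x≢y⇒x∈p-y (∈avoiding (f ∘ fsuc) (x∉f ∘ fsuc)) (x∉f fzero)

∣avoiding∣+k≤n : ∀ {n k} (f : Fin k → Fin n) → Injective _≡_ _≡_ f → ∣ avoiding f ∣ + k ≤ n
∣avoiding∣+k≤n {k = zero}  f _ = ≤-trans (≤-reflexive (+-identityʳ _)) (∣p∣≤n ⊤)
∣avoiding∣+k≤n {k = suc k} f f-inj = begin
  ∣ avoiding f ∣ + suc k        ≡⟨ +-suc _ k ⟩
  suc ∣ avoiding f ∣ + k        ≤⟨ +-monoˡ-≤ k (x∈p⇒∣p-x∣<∣p∣ f0∈rest) ⟩
  ∣ avoiding (f ∘ fsuc) ∣ + k   ≤⟨ ∣avoiding∣+k≤n (f ∘ fsuc) (Fin.suc-injective ∘ f-inj) ⟩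
  _                             ∎
  where
  open ≤-Reasoning
  f0∈rest : f fzero ∈ avoiding (f ∘ fsuc)
  f0∈rest = ∈avoiding (f ∘ fsuc) (λ i eq → Fin.0≢1+n (f-inj eq))

module _ {n : ℕ} (G : Graph n) where

  adj-sym : ∀ {x y} → Adj G x y → Adj G y x
  adj-sym {x} {y} e = trans (Graph.sym G y x) e

  adj-irrefl : ∀ {x} → ¬ Adj G x x
  adj-irrefl {x} e with trans (≡.sym e) (irrefl G x)
  ... | ()

  _∷ʳ_ : ∀ {x y z k} → Walk G x y k → Adj G y z → Walk G x z (suc k)
  [] ∷ʳ e = e ∷ []
  (e′ ∷ w) ∷ʳ e = e′ ∷ (w ∷ʳ e)

  reverse : ∀ {x y k} → Walk G x y k → Walk G y x k
  reverse [] = []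
  reverse (e ∷ w) = reverse w ∷ʳ adj-sym e

  walk₀⇒≡ : ∀ {x y} → Walk G x y 0 → x ≡ y
  walk₀⇒≡ [] = refl

  walk? : ∀ k x y → Dec (Walk G x y k)
  walk? zero x y = map′ (λ { refl → [] }) walk₀⇒≡ (x Fin.≟ y)
  walk? (suc k) x y =
    map′ (λ { (_ , e , w) → e ∷ w }) (λ { (e ∷ w) → _ , e , w })
         (any? λ z → (adj G x z Bool.≟ true) ×-dec walk? k z y)

  distance : Connected G → ∀ x y → ∃ (IsDist G x y)
  distance conn x y = minimal-witness (λ k → walk? k x y) (proj₂ (conn x y))

  dist-refl : ∀ {x} → IsDist G x x 0
  dist-refl = [] , λ _ ()

  dist-nonzero : ∀ {x y d} → IsDist G x y d → x ≢ y → d ≢ 0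
  dist-nonzero (w , _) x≢y refl = x≢y (walk₀⇒≡ w)

  Separates : Fin n → Fin n → Fin n → Set
  Separates w u v = Σ ℕ λ a → Σ ℕ λ b → IsDist G u w a × IsDist G v w b × a ≢ b

  separates-sym : ∀ {w u v} → Separates w u v → Separates w v u
  separates-sym (a , b , du , dv , a≢b) = b , a , dv , du , a≢b ∘ ≡.sym

  separates-self : Connected G → ∀ {u v} → u ≢ v → Separates u u v
  separates-self conn {u} {v} u≢v =
    let b , dv = distance conn v u
    in 0 , b , dist-refl , dv , dist-nonzero dv (u≢v ∘ ≡.sym) ∘ ≡.sym

  -- Only the vertices vtx 0, …, vtx m belong to the path; values beyond m are irrelevant.
  record Path (m : ℕ) : Set where
    field
      vtx  : ℕ → Fin n
      inj  : ∀ {i j} → i ≤ m → j ≤ m → vtx i ≡ vtx j → i ≡ j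
      step : ∀ {i} → i < m → Adj G (vtx i) (vtx (suc i))

  open Path

  take : ∀ {m k} → Path m → k ≤ m → Path k
  take P k≤m = record
    { vtx  = vtx P
    ; inj  = λ i≤k j≤k → inj P (≤-trans i≤k k≤m) (≤-trans j≤k k≤m)
    ; step = λ i<k → step P (<-≤-trans i<k k≤m)
    }

  tail : ∀ {m} → Path (suc m) → Path m
  tail P = record
    { vtx  = vtx P ∘ suc
    ; inj  = λ i≤m j≤m eq → suc-injective (inj P (s≤s i≤m) (s≤s j≤m) eq)
    ; step = λ i<m → step P (s≤s i<m)
    }

  cons : ∀ {m} (P : Path m) {x} → Adj G x (vtx P 0) → (∀ {i} → i ≤ m → x ≢ vtx P i) → Path (suc m)
  cons {m} P {x} e x∉P = record { vtx = vtx′ ; inj = inj′ ; step = step′ }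
    where
    vtx′ : ℕ → Fin n
    vtx′ zero    = x
    vtx′ (suc i) = vtx P i

    inj′ : ∀ {i j} → i ≤ suc m → j ≤ suc m → vtx′ i ≡ vtx′ j → i ≡ j
    inj′ {zero}  {zero}  _         _         _  = refl
    inj′ {zero}  {suc j} _         (s≤s j≤m) eq = ⊥-elim (x∉P j≤m eq)
    inj′ {suc i} {zero}  (s≤s i≤m) _         eq = ⊥-elim (x∉P i≤m (≡.sym eq))
    inj′ {suc i} {suc j} (s≤s i≤m) (s≤s j≤m) eq = cong suc (inj P i≤m j≤m eq)

    step′ : ∀ {i} → i < suc m → Adj G (vtx′ i) (vtx′ (suc i))
    step′ {zero}  _         = e
    step′ {suc i} (s≤s i<m) = step P i<m

  walk-to-start : ∀ {m} (P : Path m) {i} → i ≤ m → Walk G (vtx P i) (vtx P 0) i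
  walk-to-start P {zero}  _   = []
  walk-to-start P {suc i} i<m = adj-sym (step P i<m) ∷ walk-to-start P (<⇒≤ i<m)

  walk-to-end : ∀ {m} (P : Path m) {i} d → i + d ≡ m → Walk G (vtx P i) (vtx P m) d
  walk-to-end P {i} zero    i+0≡m = subst (λ j → Walk G (vtx P i) (vtx P j) 0) (trans (≡.sym (+-identityʳ i)) i+0≡m) []
  walk-to-end P {i} (suc d) i+d≡m =
    step P (subst (i <_) i+d≡m (m<m+n i z<s)) ∷ walk-to-end P d (trans (≡.sym (+-suc i d)) i+d≡m)

  record CyclicPath (m : ℕ) : Set where
    field
      path  : Path m
      close : Adj G (vtx path m) (vtx path 0)
    open Path path public

  toCycle : ∀ {t} → CyclicPath (suc (suc t)) → Cycle G (suc (suc (suc t)))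
  toCycle {t} C = record
    { m     = t
    ; len   = refl
    ; vtx   = C.vtx ∘ toℕ
    ; inj   = λ {i} {j} eq → toℕ-injective (C.inj (≤-pred (toℕ<n i)) (≤-pred (toℕ<n j)) eq)
    ; step  = λ i → subst (λ k → Adj G (C.vtx k) (C.vtx (suc (toℕ i)))) (≡.sym (toℕ-inject₁ i)) (C.step (toℕ<n i))
    ; close = subst (λ k → Adj G (C.vtx k) (C.vtx 0)) (≡.sym (toℕ-fromℕ _)) C.close
    }
    where module C = CyclicPath C

  -- A walk from one end of a path to the other that is shorter than the path must leave it
  -- and come back: following the walk until it first revisits the path closes a cycle.
  shortcut : ∀ {m k x y} (P : Path m) → x ≡ vtx P 0 → y ≡ vtx P m →
             Walk G x y k → k < m → ∃ λ ℓ → ℓ ≤ k + m × Cycle G ℓ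
  shortcut P refl y≡end [] 0<m = ⊥-elim (<⇒≢ 0<m (inj P z≤n ≤-refl y≡end))
  shortcut {suc m} {suc k} P refl refl (_∷_ {y = q} e w) (s≤s k<m)
    with anyUpTo? (λ i → q Fin.≟ vtx P i) (suc (suc m))
  ... | no q∉P =
    let ℓ , ℓ≤ , cyc = shortcut (cons P (adj-sym e) q∉P′) refl refl w (m<n⇒m<1+n (m<n⇒m<1+n k<m))
    in ℓ , ≤-trans ℓ≤ (≤-reflexive (+-suc k (suc m))) , cyc
    where
    q∉P′ : ∀ {i} → i ≤ suc m → q ≢ vtx P i
    q∉P′ {i} i≤ q≡ = q∉P (i , s≤s i≤ , q≡)
  ... | yes (zero , _ , q≡) = ⊥-elim (adj-irrefl (subst (Adj G (vtx P 0)) q≡ e))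
  ... | yes (suc zero , _ , q≡) =
    let ℓ , ℓ≤ , cyc = shortcut (tail P) q≡ refl w k<m
    in ℓ , ≤-trans ℓ≤ (≤-trans (+-monoʳ-≤ k (n≤1+n m)) (n≤1+n _)) , cyc
  ... | yes (suc (suc t) , s≤s 2+t≤1+m , q≡) =
    suc (suc (suc t)) , ≤-trans (s≤s 2+t≤1+m) (s≤s (m≤n+m (suc m) k)) ,
    toCycle (record { path = take P 2+t≤1+m ; close = subst (λ z → Adj G z (vtx P 0)) q≡ (adj-sym e) })

  rotate : ∀ {m} → CyclicPath (suc m) → CyclicPath (suc m)
  rotate {m} C = record
    { path  = record { vtx = vtx′ ; inj = inj′ ; step = step′ }
    ; close = C.step ≤-refl
    }
    where
    module C = CyclicPath C

    vtx′ : ℕ → Fin n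
    vtx′ zero    = C.vtx (suc m)
    vtx′ (suc i) = C.vtx i

    inj′ : ∀ {i j} → i ≤ suc m → j ≤ suc m → vtx′ i ≡ vtx′ j → i ≡ j
    inj′ {zero}  {zero}  _         _         _  = refl
    inj′ {zero}  {suc j} _         (s≤s j≤m) eq = ⊥-elim (1+n≰n (≤-trans (≤-reflexive (C.inj ≤-refl (m≤n⇒m≤1+n j≤m) eq)) j≤m))
    inj′ {suc i} {zero}  (s≤s i≤m) _         eq = ⊥-elim (1+n≰n (≤-trans (≤-reflexive (C.inj ≤-refl (m≤n⇒m≤1+n i≤m) (≡.sym eq))) i≤m))
    inj′ {suc i} {suc j} (s≤s i≤m) (s≤s j≤m) eq = cong suc (C.inj (m≤n⇒m≤1+n i≤m) (m≤n⇒m≤1+n j≤m) eq)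

    step′ : ∀ {i} → i < suc m → Adj G (vtx′ i) (vtx′ (suc i))
    step′ {zero}  _         = C.close
    step′ {suc i} (s≤s i<m) = C.step (m<n⇒m<1+n i<m)

  fromCycle : ∀ {ℓ} (C : Cycle G ℓ) → CyclicPath (suc (suc (Cycle.m C)))
  fromCycle C = record
    { path  = record
      { vtx  = C.vtx ∘ clamp (suc (suc C.m))
      ; inj  = λ i≤ j≤ eq → trans (≡.sym (toℕ-clamp i≤)) (trans (cong toℕ (C.inj eq)) (toℕ-clamp j≤))
      ; step = λ { {i} (s≤s i≤) → subst (λ k → Adj G (C.vtx k) (C.vtx (clamp _ (suc i)))) (inject₁-clamp i≤) (C.step (clamp _ i)) }
      }
    ; close = subst (λ k → Adj G (C.vtx k) (C.vtx fzero)) (≡.sym (clamp-self _)) C.close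
    }
    where module C = Cycle C

  module ShortestCycle {m} (C : CyclicPath (suc (suc m)))
                       (shortest : ∀ ℓ → ℓ < suc (suc (suc m)) → ¬ Cycle G ℓ) where
    open CyclicPath C using (path; close)

    arc-lower-bound : ∀ {a j} → a ≤ suc (suc m) → Walk G (vtx path a) (vtx path 0) j → j < a →
                      suc (suc (suc m)) ≤ j + a
    arc-lower-bound a≤ w j<a =
      let ℓ , ℓ≤ , cycle = shortcut (take path a≤) refl refl (reverse w) j<a
      in ≤-trans (≮⇒≥ (λ ℓ< → shortest ℓ ℓ< cycle)) ℓ≤

    distance-to-start : ∀ a → a ≤ suc (suc m) →
                        ∃ λ d → IsDist G (vtx path a) (vtx path 0) d × CycleDistance (suc (suc (suc m))) a d
    distance-to-start a a≤ with a + a ≤? suc (suc (suc m))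
    ... | yes 2a≤g = a , (walk-to-start path a≤ , no-shorter) , inj₁ refl , ≤-refl , 2a≤g
      where
      no-shorter : ∀ j → j < a → ¬ Walk G (vtx path a) (vtx path 0) j
      no-shorter j j<a w = <⇒≱ (<-≤-trans (+-monoˡ-< a j<a) 2a≤g) (arc-lower-bound a≤ w j<a)
    ... | no 2a≰g = suc e , (walk-to-end path e a+e≡ ∷ʳ close , no-shorter) , inj₂ d+a≡g , d≤a , ≤-reflexive d+a≡g
      where
      e : ℕ
      e = suc (suc m) ∸ a
      a+e≡ : a + e ≡ suc (suc m)
      a+e≡ = m+[n∸m]≡n a≤
      d+a≡g : suc e + a ≡ suc (suc (suc m))
      d+a≡g = cong suc (trans (+-comm e a) a+e≡)
      d≤a : suc e ≤ a
      d≤a = <⇒≤ (+-cancelʳ-< a (suc e) a (subst (_< a + a) (≡.sym d+a≡g) (≰⇒> 2a≰g)))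
      no-shorter : ∀ j → j < suc e → ¬ Walk G (vtx path a) (vtx path 0) j
      no-shorter j j<d w =
        <⇒≱ (subst (j + a <_) d+a≡g (+-monoˡ-< a j<d)) (arc-lower-bound a≤ w (<-≤-trans j<d d≤a))

  metricDimLe-shortestCycle : Connected G → ∀ {m} (C : CyclicPath (suc (suc m))) →
                              (∀ ℓ → ℓ < suc (suc (suc m)) → ¬ Cycle G ℓ) →
                              MetricDimLe G (n ∸ suc (suc (suc m)) + 2)
  metricDimLe-shortestCycle conn {m} C shortest = avoiding inner , resolving , size
    where
    open CyclicPath C using (path)
    module C  = ShortestCycle C shortest
    -- rotate C starts at c_{g−1}, so its vertex a + 1 is c_a.
    module C′ = ShortestCycle (rotate C) shortest

    inner : Fin (suc m) → Fin n
    inner i = vtx path (suc (toℕ i))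

    inner-index : ∀ i → suc (toℕ i) ≤ suc (suc m)
    inner-index i = s≤s (m≤n⇒m≤1+n (≤-pred (toℕ<n i)))

    inner-inj : Injective _≡_ _≡_ inner
    inner-inj {i} {j} eq = toℕ-injective (suc-injective (inj path (inner-index i) (inner-index j) eq))

    start∈W : vtx path 0 ∈ avoiding inner
    start∈W = ∈avoiding inner λ i eq → 0≢1+n (inj path z≤n (inner-index i) eq)

    end∈W : vtx path (suc (suc m)) ∈ avoiding inner
    end∈W = ∈avoiding inner λ i eq → <⇒≢ (s≤s (toℕ<n i)) (≡.sym (inj path ≤-refl (inner-index i) eq))

    inner-separated : ∀ {i j} → i ≢ j → Σ (Fin n) λ w → w ∈ avoiding inner × Separates w (inner i) (inner j)
    inner-separated {i} {j} i≢j with C.distance-to-start _ (inner-index i) | C.distance-to-start _ (inner-index j)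
    ... | d , di , Di | d′ , dj , Dj with d ≟ d′
    ...   | no d≢d′ = vtx path 0 , start∈W , d , d′ , di , dj , d≢d′
    ...   | yes refl =
      let e , ei , Ei = C′.distance-to-start _ (s≤s (toℕ<n i))
          f , ej , Ej = C′.distance-to-start _ (s≤s (toℕ<n j))
      in vtx path (suc (suc m)) , end∈W , e , f , ei , ej ,
         cycleDistance-separates (i≢j ∘ toℕ-injective ∘ suc-injective) Di Dj Ei Ej

    resolving : Resolving G (avoiding inner)
    resolving u v u≢v with any? (λ i → u Fin.≟ inner i) | any? (λ i → v Fin.≟ inner i)
    ... | no u∉ | _ = u , ∈avoiding inner (λ i eq → u∉ (i , eq)) , separates-self conn u≢v
    ... | yes _ | no v∉ =
      v , ∈avoiding inner (λ i eq → v∉ (i , eq)) , separates-sym (separates-self conn (u≢v ∘ ≡.sym))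
    ... | yes (i , refl) | yes (j , refl) = inner-separated (u≢v ∘ cong inner)

    size : ∣ avoiding inner ∣ ≤ n ∸ suc (suc (suc m)) + 2
    size = begin
      ∣ avoiding inner ∣         ≤⟨ m+n≤o⇒m≤o∸n _ (∣avoiding∣+k≤n inner inner-inj) ⟩
      n ∸ suc m                  ≤⟨ m≤n+m∸n _ 2 ⟩
      2 + (n ∸ suc m ∸ 2)        ≡⟨ +-comm 2 _ ⟩
      n ∸ suc m ∸ 2 + 2          ≡⟨ cong (_+ 2) (trans (∸-+-assoc n (suc m) 2) (cong (n ∸_) (+-comm (suc m) 2))) ⟩
      n ∸ suc (suc (suc m)) + 2  ∎
      where open ≤-Reasoning

theorem2p1 : ∀ (n : ℕ) (G : Graph n) → Connected G → HasCycle G →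
    ∀ (g : ℕ) → IsGirth G g → MetricDimLe G ((n ∸ g) + 2)
theorem2p1 n G conn _ g (C , shortest) =
  subst (λ ℓ → MetricDimLe G (n ∸ ℓ + 2)) (≡.sym len)
    (metricDimLe-shortestCycle G conn (fromCycle G C) (λ ℓ ℓ< → shortest ℓ (subst (ℓ <_) (≡.sym len) ℓ<)))
  where open Cycle C using (len)
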